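{- Let $P,Q$ be second-order polynomials and $r$ a first-order polynomial with $\deg r\ge 2$. If $r(\mathtt{L}(P))\in\mathcal{O}^2(\mathtt{L}(\mathtt{L}(Q)))$, then $P\in\mathcal{O}^2(Q)$.
   Context: $\mathrm{mon}$ denotes the set of strictly monotone functions $\mathbb{N}\to\mathbb{N}$; $p\times q$ denotes pointwise product. Second-order polynomials in a type-1 variable $\mathtt{L}$ and type-0 variable $\mathtt{n}$ are built from positive integers and $\mathtt{n}$ by $+$, $\cdot$ and $\mathtt{L}(\cdot)$; $P(p)(k)$ is the value with $\mathtt{L}:=p\in\mathrm{mon}$, $\mathtt{n}:=k$. $r(\mathtt{L}(P))$ denotes the functional $p,k\mapsto r(p(P(p)(k)))$. For such functionals $A,B$: $A\in\mathcal{O}^2(B)$ iff there exist $q\in\mathrm{mon}$, $k\in\mathbb{N}$ with $A(p)(n)\le B(p\times q)((n+1)^k)$ for all $p\in\mathrm{mon}$, $n\in\mathbb{N}$. -}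

module Defs where

open import Data.Nat using (ℕ; zero; suc; _+_; _*_; _^_; _≤_; _<_; NonZero; _⊔_)
open import Data.Product using (Σ; ∃; _×_; _,_; proj₁)

StrictMono : (ℕ → ℕ) → Set
StrictMono f = ∀ {m n} → m < n → f m < f n

mon : Set
mon = Σ (ℕ → ℕ) StrictMono

_×ₚ_ : (ℕ → ℕ) → (ℕ → ℕ) → (ℕ → ℕ)
(p ×ₚ q) n = p n * q n

data FPoly : Set where
  cst  : (c : ℕ) → .{{NonZero c}} → FPoly
  var  : FPoly
  _⊕_  : FPoly → FPoly → FPoly
  _⊗_  : FPoly → FPoly → FPoly

evalF : FPoly → ℕ → ℕ
evalF (cst c) x = c
evalF var x = x
evalF (a ⊕ b) x = evalF a x + evalF b x
evalF (a ⊗ b) x = evalF a x * evalF b x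

-- degree (coefficients are positive, so no cancellation occurs:
-- the syntactic degree is the degree of the polynomial function)
deg : FPoly → ℕ
deg (cst c) = 0
deg var = 1
deg (a ⊕ b) = deg a ⊔ deg b
deg (a ⊗ b) = deg a + deg b

-- Second-order polynomials in type-1 variable L and type-0 variable n
data SPoly : Set where
  cst  : (c : ℕ) → .{{NonZero c}} → SPoly
  var  : SPoly
  _⊕_  : SPoly → SPoly → SPoly
  _⊗_  : SPoly → SPoly → SPoly
  L    : SPoly → SPoly

evalS : SPoly → (ℕ → ℕ) → ℕ → ℕ
evalS (cst c) p k = c
evalS var p k = k
evalS (a ⊕ b) p k = evalS a p k + evalS b p k
evalS (a ⊗ b) p k = evalS a p k * evalS b p k
evalS (L a) p k = p (evalS a p k)

Functional : Set
Functional = (ℕ → ℕ) → ℕ → ℕ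

⟦_⟧ : SPoly → Functional
⟦ P ⟧ = evalS P

_∘L_ : FPoly → SPoly → Functional
(r ∘L P) p k = evalF r (p (evalS P p k))

_∈O²_ : Functional → Functional → Set
A ∈O² B = Σ mon λ q → Σ ℕ λ k →
  (p : mon) → (n : ℕ) → A (proj₁ p) n ≤ B (proj₁ p ×ₚ proj₁ q) ((n + 1) ^ k)

-- Fix the witnesses q, k of the hypothesis, a function p, an argument n, and put
-- f := p × q, T := Q(f)((n+1)^k) and W := f(T). Raise p by a huge constant H above T
-- only. Q(f)((n+1)^k) only queries f below T, so it is unchanged, and the right-hand
-- side of the hypothesis at the raised function is about H · q(W). If P at the raised
-- function exceeded T, the left-hand side would be at least H², since deg r ≥ 2; so it
-- is at most T, and P(p)(n) ≤ T by monotonicity of P in p.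
module Submission where

open import Defs
open import Data.Nat using (ℕ; zero; suc; _+_; _*_; _^_; _≤_; _<_; z≤n; s≤s; _≤?_; >-nonZero)
open import Data.Nat.Properties
open import Data.Product using (_,_; proj₁)
open import Data.Sum using (inj₁; inj₂)
open import Relation.Nullary using (yes; no; ¬_; contradiction)
open import Relation.Binary.PropositionalEquality

Monotone : (ℕ → ℕ) → Set
Monotone f = ∀ {a b} → a ≤ b → f a ≤ f b

Inflationary : (ℕ → ℕ) → Set
Inflationary f = ∀ t → t ≤ f t

StrictMono⇒Monotone : ∀ {f} → StrictMono f → Monotone f
StrictMono⇒Monotone sm a≤b with m≤n⇒m<n∨m≡n a≤b
... | inj₁ a<b  = <⇒≤ (sm a<b)
... | inj₂ refl = ≤-refl

StrictMono⇒Inflationary : ∀ {f} → StrictMono f → Inflationary f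
StrictMono⇒Inflationary sm zero    = z≤n
StrictMono⇒Inflationary sm (suc t) = ≤-trans (s≤s (StrictMono⇒Inflationary sm t)) (sm (n<1+n t))

×ₚ-inflationary : ∀ {f g} → Inflationary f → Inflationary g → Inflationary (f ×ₚ g)
×ₚ-inflationary inf-f inf-g zero    = z≤n
×ₚ-inflationary inf-f inf-g (suc t) =
  ≤-trans (≤-reflexive (sym (*-identityʳ (suc t))))
          (*-mono-≤ (inf-f (suc t)) (≤-trans (s≤s z≤n) (inf-g (suc t))))

evalS-monoˡ : ∀ P {f g} → (∀ t → f t ≤ g t) → Monotone g → ∀ n → evalS P f n ≤ evalS P g n
evalS-monoˡ (cst c)   f≤g mono-g n = ≤-refl
evalS-monoˡ var       f≤g mono-g n = ≤-refl
evalS-monoˡ (a ⊕ b)   f≤g mono-g n = +-mono-≤ (evalS-monoˡ a f≤g mono-g n) (evalS-monoˡ b f≤g mono-g n)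
evalS-monoˡ (a ⊗ b)   f≤g mono-g n = *-mono-≤ (evalS-monoˡ a f≤g mono-g n) (evalS-monoˡ b f≤g mono-g n)
evalS-monoˡ (L a)     f≤g mono-g n = ≤-trans (f≤g _) (mono-g (evalS-monoˡ a f≤g mono-g n))

evalS-positive : ∀ Q {f} → Inflationary f → ∀ {m} → 1 ≤ m → 1 ≤ evalS Q f m
evalS-positive (cst (suc c)) inf m≥1 = s≤s z≤n
evalS-positive var           inf m≥1 = m≥1
evalS-positive (a ⊕ b)       inf m≥1 = ≤-trans (evalS-positive a inf m≥1) (m≤m+n _ _)
evalS-positive (a ⊗ b)       inf m≥1 = *-mono-≤ (evalS-positive a inf m≥1) (evalS-positive b inf m≥1)
evalS-positive (L a)         inf m≥1 = ≤-trans (evalS-positive a inf m≥1) (inf _)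

-- Positivity is what makes every intermediate value bounded by the final one.
evalS-local : ∀ Q {f g} → Inflationary f → ∀ {m} → 1 ≤ m →
  (∀ t → t ≤ evalS Q f m → g t ≡ f t) → evalS Q g m ≡ evalS Q f m
evalS-local (cst c) inf m≥1 agree = refl
evalS-local var     inf m≥1 agree = refl
evalS-local (a ⊕ b) inf m≥1 agree =
  cong₂ _+_ (evalS-local a inf m≥1 λ t t≤ → agree t (≤-trans t≤ (m≤m+n _ _)))
            (evalS-local b inf m≥1 λ t t≤ → agree t (≤-trans t≤ (m≤n+m _ _)))
evalS-local (a ⊗ b) inf m≥1 agree =
  cong₂ _*_ (evalS-local a inf m≥1 λ t t≤ → agree t (≤-trans t≤ (m≤m*n _ _ {{b≢0}})))
            (evalS-local b inf m≥1 λ t t≤ → agree t (≤-trans t≤ (m≤n*m _ _ {{a≢0}})))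
  where
  a≢0 = >-nonZero (evalS-positive a inf m≥1)
  b≢0 = >-nonZero (evalS-positive b inf m≥1)
evalS-local (L a) inf m≥1 agree
  rewrite evalS-local a inf m≥1 (λ t t≤ → agree t (≤-trans t≤ (inf _))) = agree _ (inf _)

^deg≤evalF : ∀ r {y} → 1 ≤ y → y ^ deg r ≤ evalF r y
^deg≤evalF (cst (suc c)) y≥1 = s≤s z≤n
^deg≤evalF var {y}       y≥1 = ≤-reflexive (*-identityʳ y)
^deg≤evalF (a ⊕ b)       y≥1 with ≤-total (deg a) (deg b)
... | inj₁ da≤db rewrite m≤n⇒m⊔n≡n da≤db = ≤-trans (^deg≤evalF b y≥1) (m≤n+m _ _)
... | inj₂ db≤da rewrite m≥n⇒m⊔n≡m db≤da = ≤-trans (^deg≤evalF a y≥1) (m≤m+n _ _)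
^deg≤evalF (a ⊗ b) {y}   y≥1 rewrite ^-distribˡ-+-* y (deg a) (deg b) =
  *-mono-≤ (^deg≤evalF a y≥1) (^deg≤evalF b y≥1)

square≤evalF : ∀ r → 2 ≤ deg r → ∀ {y} → 1 ≤ y → y * y ≤ evalF r y
square≤evalF r deg≥2 {y} y≥1 =
  ≤-trans (≤-reflexive (cong (y *_) (sym (*-identityʳ y))))
          (≤-trans (^-monoʳ-≤ y {{>-nonZero y≥1}} deg≥2) (^deg≤evalF r y≥1))

raiseAbove : ℕ → ℕ → (ℕ → ℕ) → ℕ → ℕ
raiseAbove T H p t with t ≤? T
... | yes _ = p t
... | no  _ = p t + H

raiseAbove-≤ : ∀ {T H} p {t} → t ≤ T → raiseAbove T H p t ≡ p t
raiseAbove-≤ {T} p {t} t≤T with t ≤? T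
... | yes _   = refl
... | no  t≰T = contradiction t≤T t≰T

raiseAbove-≰ : ∀ {T H} p {t} → ¬ t ≤ T → raiseAbove T H p t ≡ p t + H
raiseAbove-≰ {T} p {t} t≰T with t ≤? T
... | yes t≤T = contradiction t≤T t≰T
... | no  _   = refl

raiseAbove-lower : ∀ {T H} p t → p t ≤ raiseAbove T H p t
raiseAbove-lower {T} p t with t ≤? T
... | yes _ = ≤-refl
... | no  _ = m≤m+n _ _

raiseAbove-upper : ∀ {T H} p t → raiseAbove T H p t ≤ p t + H
raiseAbove-upper {T} p t with t ≤? T
... | yes _ = m≤m+n _ _
... | no  _ = ≤-refl

raiseAbove-strictMono : ∀ {T H p} → StrictMono p → StrictMono (raiseAbove T H p)
raiseAbove-strictMono {T} {H} sm {a} {b} a<b with a ≤? T | b ≤? T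
... | yes _   | yes _   = sm a<b
... | yes _   | no  _   = <-≤-trans (sm a<b) (m≤m+n _ _)
... | no  a≰T | yes b≤T = contradiction (≤-trans (<⇒≤ a<b) b≤T) a≰T
... | no  _   | no  _   = +-monoˡ-< H (sm a<b)

raiseAbove-mon : ℕ → ℕ → mon → mon
raiseAbove-mon T H (p , sm) = raiseAbove T H p , raiseAbove-strictMono sm

+-*<square : ∀ a b h → a * b + b < h → (a + h) * b < h * h
+-*<square a b h ab+b<h = begin-strict
  (a + h) * b        ≡⟨ *-distribʳ-+ b a h ⟩
  a * b + h * b      <⟨ +-monoˡ-< (h * b) (≤-<-trans (m≤m+n (a * b) b) ab+b<h) ⟩
  h + h * b          ≡⟨ cong (_+ h * b) (sym (*-identityʳ h)) ⟩
  h * 1 + h * b      ≡⟨ sym (*-distribˡ-+ h 1 b) ⟩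
  h * suc b          ≤⟨ *-monoʳ-≤ h (≤-<-trans (m≤n+m b (a * b)) ab+b<h) ⟩
  h * h              ∎
  where open ≤-Reasoning

bounded-by-threshold : ∀ P r → 2 ≤ deg r → ((p , sm) : mon) (q : ℕ → ℕ) (T H n : ℕ) →
  let W = (p ×ₚ q) T ; p⁺ = raiseAbove T H p in
  p W * q W + q W < H → (r ∘L P) p⁺ n ≤ (p⁺ ×ₚ q) ((p⁺ ×ₚ q) T) → evalS P p n ≤ T
bounded-by-threshold P r deg≥2 (p , sm) q T H n H-large hyp =
  ≤-trans (evalS-monoˡ P (raiseAbove-lower p) (StrictMono⇒Monotone (raiseAbove-strictMono sm)) n)
          (≮⇒≥ λ T<x → <⇒≱ rhs<H² (≤-trans (*-mono-≤ (H≤p⁺x T<x) (H≤p⁺x T<x)) (lhs≤rhs T<x)))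
  where
  W  = (p ×ₚ q) T
  p⁺ = raiseAbove T H p
  x  = evalS P p⁺ n
  H≤p⁺x : T < x → H ≤ p⁺ x
  H≤p⁺x T<x = ≤-trans (m≤n+m H (p x)) (≤-reflexive (sym (raiseAbove-≰ p (<⇒≱ T<x))))
  p⁺×q-at-T : (p⁺ ×ₚ q) T ≡ W
  p⁺×q-at-T = cong (_* q T) (raiseAbove-≤ p ≤-refl)
  lhs≤rhs : T < x → p⁺ x * p⁺ x ≤ (p⁺ ×ₚ q) W
  lhs≤rhs T<x = ≤-trans (square≤evalF r deg≥2 (≤-trans (s≤s z≤n) (≤-trans H-large (H≤p⁺x T<x))))
                        (subst (λ v → (r ∘L P) p⁺ n ≤ (p⁺ ×ₚ q) v) p⁺×q-at-T hyp)
  rhs<H² : (p⁺ ×ₚ q) W < H * H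
  rhs<H² = ≤-<-trans (*-monoˡ-≤ (q W) (raiseAbove-upper p W)) (+-*<square (p W) (q W) H H-large)

corollary12 : (P Q : SPoly) (r : FPoly) → 2 ≤ deg r →
    (r ∘L P) ∈O² ⟦ L (L Q) ⟧ → ⟦ P ⟧ ∈O² ⟦ Q ⟧
corollary12 P Q r deg≥2 ((q , sm-q) , k , hyp) = (q , sm-q) , k , bound
  where
  bound : (p : mon) (n : ℕ) → evalS P (proj₁ p) n ≤ evalS Q (proj₁ p ×ₚ q) ((n + 1) ^ k)
  bound (p , sm-p) n =
    bounded-by-threshold P r deg≥2 (p , sm-p) q T H n ≤-refl
      (subst (λ v → (r ∘L P) p⁺ n ≤ (p⁺ ×ₚ q) ((p⁺ ×ₚ q) v)) Q-unchanged
             (hyp (raiseAbove-mon T H (p , sm-p)) n))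
    where
    m  = (n + 1) ^ k
    inf : Inflationary (p ×ₚ q)
    inf = ×ₚ-inflationary (StrictMono⇒Inflationary sm-p) (StrictMono⇒Inflationary sm-q)
    m≥1 : 1 ≤ m
    m≥1 = m^n>0 (n + 1) {{>-nonZero (m≤n+m 1 n)}} k
    T  = evalS Q (p ×ₚ q) m
    W  = (p ×ₚ q) T
    H  = suc (p W * q W + q W)
    p⁺ = raiseAbove T H p
    Q-unchanged : evalS Q (p⁺ ×ₚ q) m ≡ T
    Q-unchanged = evalS-local Q inf m≥1 λ t t≤T → cong (_* q t) (raiseAbove-≤ p t≤T)
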